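{- Let $\mathbb{L}$ be a (not necessarily commutative) ring with unity. Let $V$ be a finite set and $n=|V|$. For each $s\in V$, let $x_s\in\mathbb{L}$. Let $X,Y\in\mathbb{L}$ be such that $X+Y+\sum_{s\in V}x_s$ lies in the center of $\mathbb{L}$. Then \[ \sum_{S\subseteq V}X\Big(X+\sum_{s\in S}x_s\Big)^{|S|-1}\Big(Y+\sum_{s\in V\setminus S}x_s\Big)^{n-|S|-1}Y=(X+Y)\Big(X+Y+\sum_{s\in V}x_s\Big)^{n-1}, \] with the following interpretations: the product $X\big(X+\sum_{s\in S}x_s\big)^{|S|-1}$ is interpreted as $1$ when $S=\varnothing$; the product $\big(Y+\sum_{s\in V\setminus S}x_s\big)^{n-|S|-1}Y$ is interpreted as $1$ when $|S|=n$; and the product $(X+Y)\big(X+Y+\sum_{s\in V}x_s\big)^{n-1}$ is interpreted as $1$ when $n=0$. -}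

module Defs where

open import Level using (Level)
open import Data.Nat using (ℕ; zero; suc; _∸_)
open import Data.Fin using (Fin)
import Data.Fin as Fin
open import Data.Fin.Subset using (Subset; inside; outside)
open import Data.Vec using ([]; _∷_)
open import Algebra.Bundles using (Ring)

module RingDefs {c ℓ : Level} (R : Ring c ℓ) where
  open Ring R

  pow : Carrier → ℕ → Carrier
  pow x zero = 1#
  pow x (suc k) = x * pow x k

  Central : Carrier → Set (c Level.⊔ ℓ)
  Central z = ∀ w → z * w ≈ w * z

  sumOver : ∀ {n} → Subset n → (Fin n → Carrier) → Carrier
  sumOver [] x = 0#
  sumOver (inside ∷ p) x = x Fin.zero + sumOver p (λ i → x (Fin.suc i))
  sumOver (outside ∷ p) x = sumOver p (λ i → x (Fin.suc i))

  sumAll : ∀ n → (Fin n → Carrier) → Carrier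
  sumAll zero x = 0#
  sumAll (suc n) x = x Fin.zero + sumAll n (λ i → x (Fin.suc i))

  sumSubsets : ∀ n → (Subset n → Carrier) → Carrier
  sumSubsets zero f = f []
  sumSubsets (suc n) f =
    sumSubsets n (λ p → f (outside ∷ p)) + sumSubsets n (λ p → f (inside ∷ p))

  leftFactor : Carrier → ℕ → Carrier → Carrier
  leftFactor X zero b = 1#
  leftFactor X (suc k) b = X * pow b k

  rightFactor : Carrier → ℕ → Carrier → Carrier
  rightFactor Y zero b = 1#
  rightFactor Y (suc k) b = pow b k * Y

{-# OPTIONS --safe #-}
-- Write w = X + Y + Σ_V x, so that Y + x_{V∖S} = w − (X + x_S), and fix w central.
-- With a_T = X + x_T, consider G_{m,p}(X) = Σ_{T ⊆ [m]} a_T^{p+|T|} (w − a_T)^{m−|T|} (powerSum).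
-- Splitting off the first element gives G_{m+1,p} = w G_{m,p} + Δ G_{m,p+1}, where Δ is the
-- difference operator with step x_0; hence G_{m,p} has degree ≤ p in the sense that its
-- (p+1)-fold differences vanish, a notion that needs no commutativity. So G_{m,0} is
-- translation invariant, and this is exactly what makes the one-sided identity
--   Σ_S X a_S^{|S|−1} (w − a_S)^{n−|S|} = w^n
-- go through by induction on n. Its mirror image Σ_S a_S^{|S|} (w − a_S)^{n−|S|−1} Y = w^n is
-- the same identity in the opposite ring, with X and Y swapped and S replaced by its complement.
-- Splitting the theorem's sum at the first element yields w^{n−1} Y + X w^{n−1} = (X + Y) w^{n−1}.
module Submission where

open import Defs
open import Level using (Level; _⊔_)
open import Data.Nat using (ℕ; zero; suc; _∸_)
open import Data.Fin using (Fin)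
open import Data.Fin.Subset using (Subset; ∁; ∣_∣; inside; outside)
open import Algebra.Bundles using (Ring)

import Data.Nat as ℕ
import Data.Nat.Properties as ℕ
import Data.Fin as Fin
open import Data.Fin.Subset.Properties using (∣p∣≤n; ∣∁p∣≡n∸∣p∣)
open import Data.Bool.Properties using (not-involutive)
open import Data.Vec using ([]; _∷_)
open import Data.Vec.Properties using (map-∘; map-cong; map-id)
open import Function using (_∘_)
open import Relation.Binary.PropositionalEquality as ≡ using (_≡_)
import Algebra.Construct.Flip.Op as Flip
import Algebra.Properties.AbelianGroup as AbelianGroupProperties
import Algebra.Properties.Group as GroupProperties
import Algebra.Properties.Ring as RingProperties
import Algebra.Solver.CommutativeMonoid as CommutativeMonoidSolver
import Relation.Binary.Reasoning.Setoid as SetoidReasoning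

suc-∸-∣p∣ : ∀ {m} (T : Subset m) → suc m ∸ ∣ T ∣ ≡ suc (m ∸ ∣ T ∣)
suc-∸-∣p∣ T = ℕ.+-∸-assoc 1 (∣p∣≤n T)

∁-involutive : ∀ {m} (T : Subset m) → ∁ (∁ T) ≡ T
∁-involutive T = ≡.trans (≡.sym (map-∘ _ _ T)) (≡.trans (map-cong not-involutive T) (map-id T))

module RingLemmas {c ℓ} (R : Ring c ℓ) where
  open Ring R
  open RingDefs R
  open SetoidReasoning setoid
  open RingProperties R using (-1*x≈-x)
  open CommutativeMonoidSolver +-commutativeMonoid using (solve; _⊜_; _⊕_)

  pow-cong : ∀ {a b} k → a ≈ b → pow a k ≈ pow b k
  pow-cong zero    a≈b = refl
  pow-cong (suc k) a≈b = *-cong a≈b (pow-cong k a≈b)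

  pow-*-comm : ∀ a k → pow a k * a ≈ a * pow a k
  pow-*-comm a zero    = trans (*-identityˡ a) (sym (*-identityʳ a))
  pow-*-comm a (suc k) = begin
    (a * pow a k) * a ≈⟨ *-assoc a (pow a k) a ⟩
    a * (pow a k * a) ≈⟨ *-congˡ (pow-*-comm a k) ⟩
    a * (a * pow a k) ∎

  Central-pow : ∀ {w} → Central w → ∀ k → Central (pow w k)
  Central-pow w-central zero    z = trans (*-identityˡ z) (sym (*-identityʳ z))
  Central-pow {w} w-central (suc k) z = begin
    (w * pow w k) * z ≈⟨ *-assoc w (pow w k) z ⟩
    w * (pow w k * z) ≈⟨ *-congˡ (Central-pow w-central k z) ⟩
    w * (z * pow w k) ≈⟨ sym (*-assoc w z (pow w k)) ⟩
    (w * z) * pow w k ≈⟨ *-congʳ (w-central z) ⟩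
    (z * w) * pow w k ≈⟨ *-assoc z w (pow w k) ⟩
    z * (w * pow w k) ∎

  sumOver+sumOver∁≈sumAll : ∀ {n} (S : Subset n) (x : Fin n → Carrier) →
                            sumOver S x + sumOver (∁ S) x ≈ sumAll n x
  sumOver+sumOver∁≈sumAll []            x = +-identityˡ 0#
  sumOver+sumOver∁≈sumAll (inside ∷ S)  x =
    trans (+-assoc _ _ _) (+-congˡ (sumOver+sumOver∁≈sumAll S _))
  sumOver+sumOver∁≈sumAll (outside ∷ S) x =
    trans (solve 3 (λ a b c → a ⊕ (b ⊕ c) ⊜ b ⊕ (a ⊕ c)) refl _ _ _)
          (+-congˡ (sumOver+sumOver∁≈sumAll S _))

  sumSubsets-cong : ∀ n {f g : Subset n → Carrier} → (∀ S → f S ≈ g S) →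
                    sumSubsets n f ≈ sumSubsets n g
  sumSubsets-cong zero    f≈g = f≈g []
  sumSubsets-cong (suc n) f≈g =
    +-cong (sumSubsets-cong n (λ S → f≈g (outside ∷ S))) (sumSubsets-cong n (λ S → f≈g (inside ∷ S)))

  sumSubsets-∁ : ∀ n (f : Subset n → Carrier) → sumSubsets n f ≈ sumSubsets n (λ S → f (∁ S))
  sumSubsets-∁ zero    f = refl
  sumSubsets-∁ (suc n) f =
    trans (+-comm _ _) (+-cong (sumSubsets-∁ n _) (sumSubsets-∁ n _))

  sumSubsets-+ : ∀ n (f g : Subset n → Carrier) →
                 sumSubsets n (λ S → f S + g S) ≈ sumSubsets n f + sumSubsets n g
  sumSubsets-+ zero    f g = refl
  sumSubsets-+ (suc n) f g =
    trans (+-cong (sumSubsets-+ n _ _) (sumSubsets-+ n _ _))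
          (solve 4 (λ a b c d → (a ⊕ b) ⊕ (c ⊕ d) ⊜ (a ⊕ c) ⊕ (b ⊕ d)) refl _ _ _ _)

  sumSubsets-*ˡ : ∀ n k (f : Subset n → Carrier) →
                  sumSubsets n (λ S → k * f S) ≈ k * sumSubsets n f
  sumSubsets-*ˡ zero    k f = refl
  sumSubsets-*ˡ (suc n) k f =
    trans (+-cong (sumSubsets-*ˡ n k _) (sumSubsets-*ˡ n k _)) (sym (distribˡ k _ _))

  sumSubsets-*ʳ : ∀ n k (f : Subset n → Carrier) →
                  sumSubsets n (λ S → f S * k) ≈ sumSubsets n f * k
  sumSubsets-*ʳ zero    k f = refl
  sumSubsets-*ʳ (suc n) k f =
    trans (+-cong (sumSubsets-*ʳ n k _) (sumSubsets-*ʳ n k _)) (sym (distribʳ k _ _))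

  sumSubsets-neg : ∀ n (f : Subset n → Carrier) → sumSubsets n (λ S → - f S) ≈ - sumSubsets n f
  sumSubsets-neg n f = trans (sumSubsets-cong n (λ S → sym (-1*x≈-x (f S))))
                             (trans (sumSubsets-*ˡ n (- 1#) f) (-1*x≈-x _))

  sumSubsets-- : ∀ n (f g : Subset n → Carrier) →
                 sumSubsets n (λ S → f S - g S) ≈ sumSubsets n f - sumSubsets n g
  sumSubsets-- n f g = trans (sumSubsets-+ n f (λ S → - g S)) (+-congˡ (sumSubsets-neg n g))

module FiniteDifferences {c ℓ} (R : Ring c ℓ) where
  open Ring R
  open RingDefs R using (pow)
  open SetoidReasoning setoid
  open RingProperties R using (x[y-z]≈xy-xz)
  open GroupProperties +-group using (//-rightDividesˡ; x∙y⁻¹≈ε⇒x≈y)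
  open AbelianGroupProperties +-abelianGroup using (⁻¹-∙-comm)
  open CommutativeMonoidSolver +-commutativeMonoid using (solve; _⊜_; _⊕_)

  Δ : Carrier → (Carrier → Carrier) → Carrier → Carrier
  Δ d f X = f (X + d) - f X

  Deg< : ℕ → (Carrier → Carrier) → Set (c ⊔ ℓ)
  Deg< zero    f = ∀ X → f X ≈ 0#
  Deg< (suc p) f = ∀ d → Deg< p (Δ d f)

  Deg<-cong : ∀ p {f g} → (∀ X → f X ≈ g X) → Deg< p f → Deg< p g
  Deg<-cong zero    f≈g f-deg X = trans (sym (f≈g X)) (f-deg X)
  Deg<-cong (suc p) f≈g f-deg d = Deg<-cong p (λ X → +-cong (f≈g _) (-‿cong (f≈g X))) (f-deg d)

  Δ-+ : ∀ d f g X → Δ d (λ Z → f Z + g Z) X ≈ Δ d f X + Δ d g X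
  Δ-+ d f g X = begin
    (a + b) - (a′ + b′)     ≈⟨ +-congˡ (sym (⁻¹-∙-comm a′ b′)) ⟩
    (a + b) + (- a′ + - b′) ≈⟨ solve 4 (λ a b c d → (a ⊕ b) ⊕ (c ⊕ d) ⊜ (a ⊕ c) ⊕ (b ⊕ d)) refl a b (- a′) (- b′) ⟩
    (a - a′) + (b - b′)     ∎
    where
    a = f (X + d); b = g (X + d); a′ = f X; b′ = g X

  Deg<-+ : ∀ p {f g} → Deg< p f → Deg< p g → Deg< p (λ X → f X + g X)
  Deg<-+ zero    f-deg g-deg X = trans (+-cong (f-deg X) (g-deg X)) (+-identityˡ 0#)
  Deg<-+ (suc p) {f} {g} f-deg g-deg d =
    Deg<-cong p (λ X → sym (Δ-+ d f g X)) (Deg<-+ p (f-deg d) (g-deg d))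

  Deg<-*ˡ : ∀ p k {f} → Deg< p f → Deg< p (λ X → k * f X)
  Deg<-*ˡ zero    k f-deg X = trans (*-congˡ (f-deg X)) (zeroʳ k)
  Deg<-*ˡ (suc p) k {f} f-deg d =
    Deg<-cong p (λ X → x[y-z]≈xy-xz k (f (X + d)) (f X)) (Deg<-*ˡ p k (f-deg d))

  Deg<-suc : ∀ p {f} → Deg< p f → Deg< (suc p) f
  Deg<-suc zero    f-deg d X = trans (+-cong (f-deg _) (-‿cong (f-deg X))) (-‿inverseʳ 0#)
  Deg<-suc (suc p) f-deg d   = Deg<-suc p (f-deg d)

  Δ-x* : ∀ d f X → Δ d (λ Z → Z * f Z) X ≈ X * Δ d f X + (d * Δ d f X + d * f X)
  Δ-x* d f X = sym (begin
    X * (f₁ - f₀) + (d * (f₁ - f₀) + d * f₀)          ≈⟨ +-cong (x[y-z]≈xy-xz X f₁ f₀) (+-congʳ (x[y-z]≈xy-xz d f₁ f₀)) ⟩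
    (X * f₁ - X * f₀) + ((d * f₁ - d * f₀) + d * f₀)  ≈⟨ +-congˡ (//-rightDividesˡ (d * f₀) (d * f₁)) ⟩
    (X * f₁ - X * f₀) + d * f₁                        ≈⟨ solve 3 (λ a b c → (a ⊕ b) ⊕ c ⊜ (a ⊕ c) ⊕ b) refl (X * f₁) (- (X * f₀)) (d * f₁) ⟩
    (X * f₁ + d * f₁) - X * f₀                        ≈⟨ +-congʳ (sym (distribʳ f₁ X d)) ⟩
    (X + d) * f₁ - X * f₀                             ∎)
    where f₁ = f (X + d); f₀ = f X

  Deg<-x* : ∀ p {f} → Deg< p f → Deg< (suc p) (λ X → X * f X)
  Deg<-x* zero    f-deg d X =
    trans (+-cong (trans (*-congˡ (f-deg _)) (zeroʳ _)) (-‿cong (trans (*-congˡ (f-deg X)) (zeroʳ X))))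
          (-‿inverseʳ 0#)
  Deg<-x* (suc p) {f} f-deg d =
    Deg<-cong (suc p) (λ X → sym (Δ-x* d f X))
      (Deg<-+ (suc p) (Deg<-x* p (f-deg d))
                      (Deg<-+ (suc p) (Deg<-*ˡ (suc p) d (Deg<-suc p (f-deg d))) (Deg<-*ˡ (suc p) d f-deg)))

  Deg<-pow : ∀ p → Deg< (suc p) (λ X → pow X p)
  Deg<-pow zero    d X = -‿inverseʳ 1#
  Deg<-pow (suc p)     = Deg<-x* (suc p) (Deg<-pow p)

  Deg<1⇒shift-invariant : ∀ {f} → Deg< 1 f → ∀ X d → f (X + d) ≈ f X
  Deg<1⇒shift-invariant f-deg X d = x∙y⁻¹≈ε⇒x≈y _ _ (f-deg d X)

module PowerSums {c ℓ} (R : Ring c ℓ) (w : Ring.Carrier R) (w-central : RingDefs.Central R w) where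
  open Ring R
  open RingDefs R
  open RingLemmas R
  open FiniteDifferences R
  open SetoidReasoning setoid
  open RingProperties R using (x[y-z]≈xy-xz; [y-z]x≈yx-zx)
  open CommutativeMonoidSolver +-commutativeMonoid using (solve; _⊜_; _⊕_)

  x[[w-y]z]≈w[xz]-xyz : ∀ x y z → x * ((w - y) * z) ≈ w * (x * z) - x * y * z
  x[[w-y]z]≈w[xz]-xyz x y z = begin
    x * ((w - y) * z)           ≈⟨ *-congˡ ([y-z]x≈yx-zx z w y) ⟩
    x * (w * z - y * z)         ≈⟨ x[y-z]≈xy-xz x (w * z) (y * z) ⟩
    x * (w * z) - x * (y * z)   ≈⟨ +-cong (sym (*-assoc x w z)) (-‿cong (sym (*-assoc x y z))) ⟩
    (x * w) * z - x * y * z     ≈⟨ +-congʳ (*-congʳ (sym (w-central x))) ⟩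
    (w * x) * z - x * y * z     ≈⟨ +-congʳ (*-assoc w x z) ⟩
    w * (x * z) - x * y * z     ∎

  powerTerm : ∀ m → ℕ → (Fin m → Carrier) → Carrier → Subset m → Carrier
  powerTerm m p x X T = pow (X + sumOver T x) (p ℕ.+ ∣ T ∣) * pow (w - (X + sumOver T x)) (m ∸ ∣ T ∣)

  powerSum : ∀ m → ℕ → (Fin m → Carrier) → Carrier → Carrier
  powerSum m p x X = sumSubsets m (powerTerm m p x X)

  powerSum-suc : ∀ m p x X →
    powerSum (suc m) p x X ≈ w * powerSum m p (x ∘ Fin.suc) X + Δ (x Fin.zero) (powerSum m (suc p) (x ∘ Fin.suc)) X
  powerSum-suc m p x X = begin
    powerSum (suc m) p x X
      ≈⟨ +-cong (sumSubsets-cong m outside-term) (sumSubsets-cong m inside-term) ⟩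
    sumSubsets m (λ T → w * powerTerm m p x′ X T - powerTerm m (suc p) x′ X T) + powerSum m (suc p) x′ (X + x₀)
      ≈⟨ +-congʳ (trans (sumSubsets-- m _ _) (+-congʳ (sumSubsets-*ˡ m w _))) ⟩
    (w * powerSum m p x′ X - powerSum m (suc p) x′ X) + powerSum m (suc p) x′ (X + x₀)
      ≈⟨ solve 3 (λ a b c → (a ⊕ b) ⊕ c ⊜ a ⊕ (c ⊕ b)) refl _ _ _ ⟩
    w * powerSum m p x′ X + Δ x₀ (powerSum m (suc p) x′) X ∎
    where
    x₀ = x Fin.zero
    x′ = x ∘ Fin.suc
    outside-term : ∀ T → powerTerm (suc m) p x X (outside ∷ T) ≈ w * powerTerm m p x′ X T - powerTerm m (suc p) x′ X T
    outside-term T = begin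
      pow a q * pow (w - a) (suc m ∸ ∣ T ∣)  ≡⟨ ≡.cong (λ j → pow a q * pow (w - a) j) (suc-∸-∣p∣ T) ⟩
      pow a q * ((w - a) * B)               ≈⟨ x[[w-y]z]≈w[xz]-xyz (pow a q) a B ⟩
      w * (pow a q * B) - pow a q * a * B   ≈⟨ +-congˡ (-‿cong (*-congʳ (pow-*-comm a q))) ⟩
      w * (pow a q * B) - a * pow a q * B   ∎
      where
      a = X + sumOver T x′
      q = p ℕ.+ ∣ T ∣
      B = pow (w - a) (m ∸ ∣ T ∣)
    inside-term : ∀ T → powerTerm (suc m) p x X (inside ∷ T) ≈ powerTerm m (suc p) x′ (X + x₀) T
    inside-term T =
      *-cong (trans (pow-cong (p ℕ.+ suc ∣ T ∣) a≈a′) (reflexive (≡.cong (pow a′) (ℕ.+-suc p ∣ T ∣))))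
             (pow-cong (m ∸ ∣ T ∣) (+-congˡ (-‿cong a≈a′)))
      where
      a′ = (X + x₀) + sumOver T x′
      a≈a′ : X + (x₀ + sumOver T x′) ≈ a′
      a≈a′ = sym (+-assoc X x₀ (sumOver T x′))

  powerSum-degree : ∀ m p x → Deg< (suc p) (powerSum m p x)
  powerSum-degree zero    p x = Deg<-cong (suc p) pow≈powerSum (Deg<-pow p)
    where
    pow≈powerSum : ∀ X → pow X p ≈ powerSum 0 p x X
    pow≈powerSum X = sym (trans (*-identityʳ _)
      (trans (reflexive (≡.cong (pow (X + 0#)) (ℕ.+-identityʳ p))) (pow-cong p (+-identityʳ X))))
  powerSum-degree (suc m) p x =
    Deg<-cong (suc p) (λ X → sym (powerSum-suc m p x X))
      (Deg<-+ (suc p) (Deg<-*ˡ (suc p) w (powerSum-degree m p (x ∘ Fin.suc)))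
                      (powerSum-degree m (suc p) (x ∘ Fin.suc) (x Fin.zero)))

  powerSum₀-shift : ∀ m x X d → powerSum m 0 x (X + d) ≈ powerSum m 0 x X
  powerSum₀-shift m x = Deg<1⇒shift-invariant (powerSum-degree m 0 x)

  leftFactor-*≈*pow : ∀ {m} (T : Subset m) x X →
    leftFactor X ∣ T ∣ (X + sumOver T x) * (X + sumOver T x) ≈ X * pow (X + sumOver T x) (∣ T ∣)
  leftFactor-*≈*pow []            x X = trans (*-identityˡ _) (trans (+-identityʳ X) (sym (*-identityʳ X)))
  leftFactor-*≈*pow (outside ∷ T) x X = leftFactor-*≈*pow T (x ∘ Fin.suc) X
  leftFactor-*≈*pow (inside ∷ T)  x X = trans (*-assoc X _ _) (*-congˡ (pow-*-comm _ ∣ T ∣))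

  leftTerm : ∀ m → (Fin m → Carrier) → Carrier → Subset m → Carrier
  leftTerm m x X T = leftFactor X ∣ T ∣ (X + sumOver T x) * pow (w - (X + sumOver T x)) (m ∸ ∣ T ∣)

  sum-leftTerm≈pow : ∀ m x X → sumSubsets m (leftTerm m x X) ≈ pow w m
  sum-leftTerm≈pow zero    x X = *-identityˡ 1#
  sum-leftTerm≈pow (suc m) x X = begin
    sumSubsets (suc m) (leftTerm (suc m) x X)
      ≈⟨ +-cong (sumSubsets-cong m outside-term) (sumSubsets-cong m inside-term) ⟩
    sumSubsets m (λ T → w * leftTerm m x′ X T - X * powerTerm m 0 x′ X T)
      + sumSubsets m (λ T → X * powerTerm m 0 x′ (X + x₀) T)
      ≈⟨ +-cong (trans (sumSubsets-- m _ _) (+-cong (sumSubsets-*ˡ m w _) (-‿cong (sumSubsets-*ˡ m X _))))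
                (sumSubsets-*ˡ m X _) ⟩
    (w * sumSubsets m (leftTerm m x′ X) - X * powerSum m 0 x′ X) + X * powerSum m 0 x′ (X + x₀)
      ≈⟨ +-cong (+-congʳ (*-congˡ (sum-leftTerm≈pow m x′ X))) (*-congˡ (powerSum₀-shift m x′ X x₀)) ⟩
    (w * pow w m - X * powerSum m 0 x′ X) + X * powerSum m 0 x′ X
      ≈⟨ //-rightDividesˡ _ _ ⟩
    w * pow w m ∎
    where
    open GroupProperties +-group using (//-rightDividesˡ)
    x₀ = x Fin.zero
    x′ = x ∘ Fin.suc
    outside-term : ∀ T → leftTerm (suc m) x X (outside ∷ T) ≈ w * leftTerm m x′ X T - X * powerTerm m 0 x′ X T
    outside-term T = begin
      L * pow (w - a) (suc m ∸ ∣ T ∣)  ≡⟨ ≡.cong (λ j → L * pow (w - a) j) (suc-∸-∣p∣ T) ⟩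
      L * ((w - a) * B)               ≈⟨ x[[w-y]z]≈w[xz]-xyz L a B ⟩
      w * (L * B) - L * a * B         ≈⟨ +-congˡ (-‿cong (trans (*-congʳ (leftFactor-*≈*pow T x′ X)) (*-assoc X _ _))) ⟩
      w * (L * B) - X * (pow a ∣ T ∣ * B) ∎
      where
      a = X + sumOver T x′
      L = leftFactor X ∣ T ∣ a
      B = pow (w - a) (m ∸ ∣ T ∣)
    inside-term : ∀ T → leftTerm (suc m) x X (inside ∷ T) ≈ X * powerTerm m 0 x′ (X + x₀) T
    inside-term T = trans (*-assoc X _ _)
      (*-congˡ (*-cong (pow-cong ∣ T ∣ a≈a′) (pow-cong (m ∸ ∣ T ∣) (+-congˡ (-‿cong a≈a′)))))
      where
      a≈a′ : X + (x₀ + sumOver T x′) ≈ (X + x₀) + sumOver T x′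
      a≈a′ = sym (+-assoc X x₀ (sumOver T x′))

module LeftAbel {c ℓ} (R : Ring c ℓ) where
  open Ring R
  open RingDefs R
  open RingLemmas R
  open SetoidReasoning setoid
  open GroupProperties +-group using (//-rightDividesʳ)
  open CommutativeMonoidSolver +-commutativeMonoid using (solve; _⊜_; _⊕_)

  abel-left : ∀ m (x : Fin m → Carrier) X Y {w} → Central w → w ≈ X + Y + sumAll m x →
    sumSubsets m (λ T → leftFactor X ∣ T ∣ (X + sumOver T x) * pow (Y + sumOver (∁ T) x) (m ∸ ∣ T ∣))
      ≈ pow w m
  abel-left m x X Y {w} w-central w≈ =
    trans (sumSubsets-cong m (λ T → *-congˡ (pow-cong (m ∸ ∣ T ∣) (complement≈w- T))))
          (PowerSums.sum-leftTerm≈pow R w w-central m x X)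
    where
    complement≈w- : ∀ T → Y + sumOver (∁ T) x ≈ w - (X + sumOver T x)
    complement≈w- T = begin
      b               ≈⟨ sym (//-rightDividesʳ a b) ⟩
      (b + a) - a     ≈⟨ +-congʳ b+a≈w ⟩
      w - a           ∎
      where
      a = X + sumOver T x
      b = Y + sumOver (∁ T) x
      b+a≈w : b + a ≈ w
      b+a≈w = begin
        b + a                                      ≈⟨ solve 4 (λ X Y s s′ → (Y ⊕ s′) ⊕ (X ⊕ s) ⊜ (X ⊕ Y) ⊕ (s ⊕ s′)) refl X Y _ _ ⟩
        X + Y + (sumOver T x + sumOver (∁ T) x)    ≈⟨ +-congˡ (sumOver+sumOver∁≈sumAll T x) ⟩
        X + Y + sumAll m x                         ≈⟨ sym w≈ ⟩
        w                                          ∎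

module RightAbel {c ℓ} (R : Ring c ℓ) where
  open Ring R
  open RingDefs R
  open RingLemmas R
  open SetoidReasoning setoid
  module Op = RingDefs (Flip.ring R)

  sumOver-flip : ∀ {n} (S : Subset n) (x : Fin n → Carrier) → Op.sumOver S x ≡ sumOver S x
  sumOver-flip []            x = ≡.refl
  sumOver-flip (inside ∷ S)  x = ≡.cong (x Fin.zero +_) (sumOver-flip S (x ∘ Fin.suc))
  sumOver-flip (outside ∷ S) x = sumOver-flip S (x ∘ Fin.suc)

  sumAll-flip : ∀ n (x : Fin n → Carrier) → Op.sumAll n x ≡ sumAll n x
  sumAll-flip zero    x = ≡.refl
  sumAll-flip (suc n) x = ≡.cong (x Fin.zero +_) (sumAll-flip n (x ∘ Fin.suc))

  sumSubsets-flip : ∀ n (f : Subset n → Carrier) → Op.sumSubsets n f ≡ sumSubsets n f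
  sumSubsets-flip zero    f = ≡.refl
  sumSubsets-flip (suc n) f = ≡.cong₂ _+_ (sumSubsets-flip n _) (sumSubsets-flip n _)

  pow-flip : ∀ a k → Op.pow a k ≈ pow a k
  pow-flip a zero    = refl
  pow-flip a (suc k) = trans (*-congʳ (pow-flip a k)) (pow-*-comm a k)

  leftFactor-flip : ∀ Y k b → Op.leftFactor Y k b ≈ rightFactor Y k b
  leftFactor-flip Y zero    b = refl
  leftFactor-flip Y (suc k) b = *-congʳ (pow-flip b k)

  abel-right : ∀ m (x : Fin m → Carrier) X Y {w} → Central w → w ≈ X + Y + sumAll m x →
    sumSubsets m (λ T → pow (X + sumOver T x) (∣ T ∣) * rightFactor Y (m ∸ ∣ T ∣) (Y + sumOver (∁ T) x))
      ≈ pow w m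
  abel-right m x X Y {w} w-central w≈ = begin
    sumSubsets m (λ T → pow (X + sumOver T x) (∣ T ∣) * rightFactor Y (m ∸ ∣ T ∣) (Y + sumOver (∁ T) x))
      ≈⟨ sumSubsets-∁ m _ ⟩
    sumSubsets m (λ S → pow (X + sumOver (∁ S) x) (∣ ∁ S ∣) * rightFactor Y (m ∸ ∣ ∁ S ∣) (Y + sumOver (∁ (∁ S)) x))
      ≈⟨ sumSubsets-cong m (λ S → *-cong (pow-term S) (rightFactor-term S)) ⟩
    sumSubsets m flipped-term
      ≡⟨ sumSubsets-flip m flipped-term ⟨
    Op.sumSubsets m flipped-term
      ≈⟨ LeftAbel.abel-left (Flip.ring R) m x Y X (λ z → sym (w-central z)) w≈′ ⟩
    Op.pow w m
      ≈⟨ pow-flip w m ⟩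
    pow w m ∎
    where
    flipped-term : Subset m → Carrier
    flipped-term S = Op.pow (X + Op.sumOver (∁ S) x) (m ∸ ∣ S ∣) * Op.leftFactor Y (∣ S ∣) (Y + Op.sumOver S x)
    pow-term : ∀ S → pow (X + sumOver (∁ S) x) (∣ ∁ S ∣) ≈ Op.pow (X + Op.sumOver (∁ S) x) (m ∸ ∣ S ∣)
    pow-term S = begin
      pow (X + sumOver (∁ S) x) (∣ ∁ S ∣)           ≡⟨ ≡.cong (pow _) (∣∁p∣≡n∸∣p∣ S) ⟩
      pow (X + sumOver (∁ S) x) (m ∸ ∣ S ∣)         ≈⟨ pow-flip (X + sumOver (∁ S) x) (m ∸ ∣ S ∣) ⟨
      Op.pow (X + sumOver (∁ S) x) (m ∸ ∣ S ∣)      ≡⟨ ≡.cong (λ s → Op.pow (X + s) (m ∸ ∣ S ∣)) (sumOver-flip (∁ S) x) ⟨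
      Op.pow (X + Op.sumOver (∁ S) x) (m ∸ ∣ S ∣)   ∎
    rightFactor-term : ∀ S → rightFactor Y (m ∸ ∣ ∁ S ∣) (Y + sumOver (∁ (∁ S)) x) ≈ Op.leftFactor Y (∣ S ∣) (Y + Op.sumOver S x)
    rightFactor-term S = begin
      rightFactor Y (m ∸ ∣ ∁ S ∣) (Y + sumOver (∁ (∁ S)) x)  ≡⟨ ≡.cong₂ (λ k T → rightFactor Y k (Y + sumOver T x)) m∸∣∁S∣≡∣S∣ (∁-involutive S) ⟩
      rightFactor Y (∣ S ∣) (Y + sumOver S x)                  ≈⟨ leftFactor-flip Y (∣ S ∣) _ ⟨
      Op.leftFactor Y (∣ S ∣) (Y + sumOver S x)                ≡⟨ ≡.cong (λ s → Op.leftFactor Y (∣ S ∣) (Y + s)) (sumOver-flip S x) ⟨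
      Op.leftFactor Y (∣ S ∣) (Y + Op.sumOver S x)             ∎
      where
      m∸∣∁S∣≡∣S∣ : m ∸ ∣ ∁ S ∣ ≡ ∣ S ∣
      m∸∣∁S∣≡∣S∣ = ≡.trans (≡.cong (m ∸_) (∣∁p∣≡n∸∣p∣ S)) (ℕ.m∸[m∸n]≡n (∣p∣≤n S))
    w≈′ : w ≈ Y + X + Op.sumAll m x
    w≈′ = trans w≈ (+-cong (+-comm X Y) (reflexive (≡.sym (sumAll-flip m x))))

module FirstElementSplit {c ℓ} (R : Ring c ℓ) where
  open Ring R
  open RingDefs R
  open RingLemmas R
  open SetoidReasoning setoid

  summand : ∀ n → (Fin n → Carrier) → Carrier → Carrier → Subset n → Carrier
  summand n x X Y S = leftFactor X ∣ S ∣ (X + sumOver S x) * rightFactor Y (n ∸ ∣ S ∣) (Y + sumOver (∁ S) x)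

  summand-outside : ∀ m x X Y (T : Subset m) → let x′ = x ∘ Fin.suc in
    summand (suc m) x X Y (outside ∷ T)
      ≈ leftFactor X ∣ T ∣ (X + sumOver T x′) * pow (Y + x Fin.zero + sumOver (∁ T) x′) (m ∸ ∣ T ∣) * Y
  summand-outside m x X Y T = begin
    L * rightFactor Y (suc m ∸ ∣ T ∣) b       ≡⟨ ≡.cong (λ j → L * rightFactor Y j b) (suc-∸-∣p∣ T) ⟩
    L * (pow b (m ∸ ∣ T ∣) * Y)              ≈⟨ *-assoc L _ Y ⟨
    L * pow b (m ∸ ∣ T ∣) * Y                ≈⟨ *-congʳ (*-congˡ (pow-cong (m ∸ ∣ T ∣) (sym (+-assoc Y _ _)))) ⟩
    L * pow b′ (m ∸ ∣ T ∣) * Y               ∎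
    where
    L = leftFactor X ∣ T ∣ (X + sumOver T (x ∘ Fin.suc))
    b = Y + (x Fin.zero + sumOver (∁ T) (x ∘ Fin.suc))
    b′ = Y + x Fin.zero + sumOver (∁ T) (x ∘ Fin.suc)

  summand-inside : ∀ m x X Y (T : Subset m) → let x′ = x ∘ Fin.suc in
    summand (suc m) x X Y (inside ∷ T)
      ≈ X * (pow (X + x Fin.zero + sumOver T x′) (∣ T ∣) * rightFactor Y (m ∸ ∣ T ∣) (Y + sumOver (∁ T) x′))
  summand-inside m x X Y T =
    trans (*-assoc X _ _) (*-congˡ (*-congʳ (pow-cong ∣ T ∣ (sym (+-assoc X _ _)))))

theorem2p7 : {c ℓ : Level} (R : Ring c ℓ) (n : ℕ) (x : Fin n → Ring.Carrier R) (X Y : Ring.Carrier R) →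
    let open Ring R
        open RingDefs R
    in Central (X + Y + sumAll n x) →
       sumSubsets n (λ S → leftFactor X ∣ S ∣ (X + sumOver S x) * rightFactor Y (n ∸ ∣ S ∣) (Y + sumOver (∁ S) x))
         ≈ leftFactor (X + Y) n (X + Y + sumAll n x)
theorem2p7 R zero    x X Y w-central = Ring.*-identityˡ R (Ring.1# R)
theorem2p7 R (suc m) x X Y w-central = begin
  sumSubsets (suc m) (summand (suc m) x X Y)
    ≈⟨ +-cong (sumSubsets-cong m (summand-outside m x X Y)) (sumSubsets-cong m (summand-inside m x X Y)) ⟩
  sumSubsets m (λ T → leftSummand T * Y) + sumSubsets m (λ T → X * rightSummand T)
    ≈⟨ +-cong (sumSubsets-*ʳ m Y leftSummand) (sumSubsets-*ˡ m X rightSummand) ⟩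
  sumSubsets m leftSummand * Y + X * sumSubsets m rightSummand
    ≈⟨ +-cong (*-congʳ (abel-left m x′ X (Y + x₀) w-central w≈X+[Y+x₀]+Σx′))
              (*-congˡ (abel-right m x′ (X + x₀) Y w-central w≈[X+x₀]+Y+Σx′)) ⟩
  pow w m * Y + X * pow w m
    ≈⟨ +-cong (Central-pow w-central m Y) refl ⟩
  Y * pow w m + X * pow w m
    ≈⟨ trans (+-comm _ _) (sym (distribʳ (pow w m) X Y)) ⟩
  (X + Y) * pow w m ∎
  where
  open Ring R
  open RingDefs R
  open RingLemmas R
  open LeftAbel R using (abel-left)
  open RightAbel R using (abel-right)
  open FirstElementSplit R
  open SetoidReasoning setoid
  open CommutativeMonoidSolver +-commutativeMonoid using (solve; _⊜_; _⊕_)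
  x₀ = x Fin.zero
  x′ = x ∘ Fin.suc
  w = X + Y + sumAll (suc m) x
  leftSummand rightSummand : Subset m → Carrier
  leftSummand T = leftFactor X ∣ T ∣ (X + sumOver T x′) * pow (Y + x₀ + sumOver (∁ T) x′) (m ∸ ∣ T ∣)
  rightSummand T = pow (X + x₀ + sumOver T x′) (∣ T ∣) * rightFactor Y (m ∸ ∣ T ∣) (Y + sumOver (∁ T) x′)
  w≈X+[Y+x₀]+Σx′ : w ≈ X + (Y + x₀) + sumAll m x′
  w≈X+[Y+x₀]+Σx′ = solve 4 (λ X Y a b → (X ⊕ Y) ⊕ (a ⊕ b) ⊜ (X ⊕ (Y ⊕ a)) ⊕ b) refl X Y x₀ _
  w≈[X+x₀]+Y+Σx′ : w ≈ X + x₀ + Y + sumAll m x′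
  w≈[X+x₀]+Y+Σx′ = solve 4 (λ X Y a b → (X ⊕ Y) ⊕ (a ⊕ b) ⊜ ((X ⊕ a) ⊕ Y) ⊕ b) refl X Y x₀ _
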